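{- Let $a\neq 0$ be a complex number, let $n,m\geq1$ be integers and $1\leq k\leq n$. Then $$\sum_{l_{1},\dots,l_{m-1}=0}^{n}\binom{n-1}{l_{1}-1}\binom{l_{1}-1}{l_{2}-1}\cdots\binom{l_{m-2}-1}{l_{m-1}-1}\binom{l_{m-1}-1}{k-1}(-an)^{n-l_{1}}(-al_{1})^{l_{1}-l_{2}}\cdots(-al_{m-2})^{l_{m-2}-l_{m-1}}(-al_{m-1})^{l_{m-1}-k}$$ $$=\sum_{\substack{k_{1}+k_{2}+\cdots+k_{m}=n-k\\ k_1,\dots,k_m\geq0}}\binom{n-1}{k_{1},k_{2},\dots,k_{m},k-1}\prod_{i=1}^{m}\bigl(-a(n-k_{m}-\cdots-k_{i+1})\bigr)^{k_{i}},$$ where in the product the factor with $i=m$ is $(-an)^{k_m}$.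
   Context: Binomial coefficients $\binom{p}{q}$ are taken to be $0$ when $q<0$ or $q>p$ (so any term of the left-hand sum in which the chain $n\geq l_1\geq l_2\geq\cdots\geq l_{m-1}\geq k$ with all $l_i\geq1$ fails is zero). For $m=1$ the left-hand side has no summation indices and is read as $\binom{n-1}{k-1}(-an)^{n-k}$. The multinomial coefficient is $\binom{n-1}{k_1,\dots,k_m,k-1}=\frac{(n-1)!}{k_1!\cdots k_m!\,(k-1)!}$. (These quantities arise from the Abel polynomials $A_n(x;a)=x(x-an)^{n-1}=\sum_{k=1}^n\binom{n-1}{k-1}(-an)^{n-k}x^k$.) -}

module Defs where

open import Level using (Level)
import Algebra.Bundles
open Algebra.Bundles using (CommutativeRing)
open import Data.Nat as ℕ using (ℕ; zero; suc; _∸_; _!; NonZero)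
open import Data.Nat.Properties using (m*n≢0; _!≢0)
open import Data.Nat.Combinatorics using (_C_)
open import Data.List using (List; []; _∷_; map; foldr; upTo; concatMap)
open import Data.Vec using (Vec; []; _∷_; toList)

prodFact : List ℕ → ℕ
prodFact []       = 1
prodFact (x ∷ xs) = (x !) ℕ.* prodFact xs

prodFact-nz : ∀ xs → NonZero (prodFact xs)
prodFact-nz []       = _
prodFact-nz (x ∷ xs) = m*n≢0 (x !) (prodFact xs) {{x !≢0}} {{prodFact-nz xs}}

-- Multinomial coefficient  N! / (x₁! ⋯ x_r!)  (paper's definition as a ratio
-- of factorials; used with N = x₁ + ⋯ + x_r, so the division is exact).
multinomial : ℕ → List ℕ → ℕ
multinomial N xs = (N !) ℕ./ prodFact xs
  where instance _ = prodFact-nz xs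

-- "Shifted" binomial  bin p q = binom(p-1, q-1) with the convention that
-- binom(P, Q) = 0 when Q < 0 or Q > P (P, Q integers).
bin : ℕ → ℕ → ℕ
bin zero    _       = 0          -- binom(-1, q-1) = 0 (q-1 ≥ 0 > -1, or q-1 = -1 < 0)
bin (suc p) zero    = 0          -- binom(p, -1) = 0
bin (suc p) (suc q) = p C q

compositions : (m r : ℕ) → List (Vec ℕ m)
compositions zero    zero    = [] ∷ []
compositions zero    (suc r) = []
compositions (suc m) r =
  concatMap (λ j → map (j ∷_) (compositions m (r ∸ j))) (upTo (suc r))

vsum : ∀ {m} → Vec ℕ m → ℕ
vsum []       = 0
vsum (x ∷ xs) = x ℕ.+ vsum xs

module _ {c ℓ : Level} (R : CommutativeRing c ℓ) where
  open CommutativeRing R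
  open import Algebra.Definitions.RawSemiring (Algebra.Bundles.Semiring.rawSemiring semiring) using (_×_; _^_)

  sumTo : ℕ → (ℕ → Carrier) → Carrier
  sumTo n f = foldr _+_ 0# (map f (upTo (suc n)))

  ΣList : List Carrier → Carrier
  ΣList = foldr _+_ 0#

  negMul : Carrier → ℕ → Carrier
  negMul a l = - (l × a)

  -- Left-hand side. chain a n k j l is the nested sum over j further indices
  -- l' ranging over 0..n, starting from the current index l:
  --   chain 0 l       = binom(l-1,k-1) (-a l)^(l-k)
  --   chain (j+1) l   = Σ_{l'=0}^{n} binom(l-1,l'-1) (-a l)^(l-l') chain j l'
  -- (when l < l' or l < k the binomial is 0, so truncated subtraction in the
  -- exponent is harmless).
  chain : (a : Carrier) (n k : ℕ) → ℕ → ℕ → Carrier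
  chain a n k zero    l = (bin l k × 1#) * (negMul a l ^ (l ∸ k))
  chain a n k (suc j) l =
    sumTo n (λ l' → (bin l l' × 1#) * (negMul a l ^ (l ∸ l')) * chain a n k j l')

  LHS : (a : Carrier) (n m k : ℕ) → Carrier
  LHS a n m k = chain a n k (m ∸ 1) n

  prodTerm : (a : Carrier) (n : ℕ) → ∀ {m} → Vec ℕ m → Carrier
  prodTerm a n []       = 1#
  prodTerm a n (x ∷ xs) = (negMul a (n ∸ vsum xs) ^ x) * prodTerm a n xs

  RHS : (a : Carrier) (n m k : ℕ) → Carrier
  RHS a n m k =
    ΣList (map (λ ks → (multinomial (n ∸ 1) (toList ks Data.List.++ ((k ∸ 1) ∷ [])) × 1#)
                       * prodTerm a n ks)
               (compositions m (n ∸ k)))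

{-# OPTIONS --safe #-}
-- Let K l k = binom(l-1,k-1) (-a l)^(l-k), the coefficient of x^k in the Abel
-- polynomial A_l(x;a). The left-hand side is the (n,k) entry of the m-th power
-- of the triangular matrix K, so it can also be unfolded at the k end:
-- L_{m+1}(k) = Σ_l L_m(l) K l k. The right-hand side obeys the same recursion:
-- split off the first part k₁ = j of a composition; merging j with the last
-- entry k-1 of the multinomial coefficient produces binom(k-1+j, k-1), and the
-- first factor of the product becomes (-a(k+j))^j, so together they give
-- K (k+j) k. For m = 1 both sides are K n k.
module Submission where

open import Defs
open import Algebra.Bundles using (CommutativeRing; module Semiring)
open import Data.Nat as ℕ using (ℕ; zero; suc; _≤_; _<_; _∸_; s≤s; z≤n; z<s)
import Data.Nat.Properties as ℕₚ
open import Data.Nat.Combinatorics using (_C_; k>n⇒nCk≡0)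
open import Data.Fin using (toℕ)
open import Data.Fin.Properties using (toℕ<n)
open import Data.List using (List; []; _∷_; _++_; map; foldr; applyUpTo; concatMap)
open import Data.List.Properties using (map-++; map-∘)
open import Data.Vec using (Vec; []; _∷_; toList)
open import Data.Nat.Solver using (module +-*-Solver)
open import Function using (_∘_)
open import Relation.Nullary using (¬_)
open import Relation.Binary.PropositionalEquality as ≡ using (_≡_)

module Multinomial where
  open import Data.Nat
  open import Data.Nat.Properties
  open import Data.Nat.Combinatorics using (_C_; nCk≡n!/k![n-k]!; k![n∸k]!∣n!)
  open import Data.Nat.DivMod using (m/n*n≡m)
  open import Data.Nat.Divisibility using (_∣_; ∣-trans; *-monoʳ-∣; 1∣_; n∣m*n)
  open import Data.Nat.ListAction using (sum)
  open import Data.Nat.ListAction.Properties using (sum-++)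
  open import Relation.Binary.PropositionalEquality
  open +-*-Solver

  sum-toList : ∀ {m} (ks : Vec ℕ m) → sum (toList ks) ≡ vsum ks
  sum-toList []       = refl
  sum-toList (k ∷ ks) = cong (k +_) (sum-toList ks)

  prodFact-++ : ∀ xs ys → prodFact (xs ++ ys) ≡ prodFact xs * prodFact ys
  prodFact-++ []       ys = sym (+-identityʳ _)
  prodFact-++ (x ∷ xs) ys = trans (cong (x ! *_) (prodFact-++ xs ys)) (sym (*-assoc (x !) _ _))

  C*!*!≡! : ∀ m n → ((m + n) C m) * (m ! * n !) ≡ (m + n) !
  C*!*!≡! m n = begin
    ((m + n) C m) * (m ! * n !)           ≡⟨ cong (λ o → ((m + n) C m) * (m ! * o !)) (m+n∸m≡n m n) ⟨
    ((m + n) C m) * (m ! * (m + n ∸ m) !) ≡⟨ binomial-exact (m≤m+n m n) ⟩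
    (m + n) !                             ∎
    where
    open ≡-Reasoning
    binomial-exact : ∀ {N k} → k ≤ N → (N C k) * (k ! * (N ∸ k) !) ≡ N !
    binomial-exact {N} {k} k≤N = trans (cong (_* (k ! * (N ∸ k) !)) (nCk≡n!/k![n-k]! k≤N))
      (m/n*n≡m {{k !* (N ∸ k) !≢0}} (k![n∸k]!∣n! k≤N))

  prodFact∣sum! : ∀ xs → prodFact xs ∣ sum xs !
  prodFact∣sum! []       = 1∣ 1
  prodFact∣sum! (x ∷ xs) =
    ∣-trans (*-monoʳ-∣ (x !) (prodFact∣sum! xs))
            (subst (x ! * sum xs ! ∣_) (C*!*!≡! x (sum xs)) (n∣m*n ((x + sum xs) C x)))

  multinomial*prodFact : ∀ {N} xs → sum xs ≡ N → multinomial N xs * prodFact xs ≡ N !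
  multinomial*prodFact xs refl = m/n*n≡m {{prodFact-nz xs}} (prodFact∣sum! xs)

  multinomial-merge : ∀ {N} j c L → j + sum L + c ≡ N →
    multinomial N (j ∷ L ++ c ∷ []) ≡ ((c + j) C c) * multinomial N (L ++ c + j ∷ [])
  multinomial-merge {N} j c L eq =
    *-cancelʳ-≡ _ _ (prodFact xs) {{prodFact-nz xs}} (begin
      M₁ * prodFact xs                          ≡⟨ multinomial*prodFact xs sum-xs ⟩
      N !                                       ≡⟨ multinomial*prodFact ys sum-ys ⟨
      M₂ * prodFact ys                          ≡⟨ cong (M₂ *_) prodFact-ys ⟩
      M₂ * (prodFact L * ((B * (c ! * j !)) * 1))
        ≡⟨ solve 5 (λ m p b x y → m :* (p :* ((b :* (x :* y)) :* con 1))
                                 := b :* m :* (y :* (p :* (x :* con 1)))) refl M₂ (prodFact L) B (c !) (j !) ⟩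
      B * M₂ * (j ! * (prodFact L * (c ! * 1))) ≡⟨ cong ((B * M₂) *_) (cong (j ! *_) (prodFact-++ L (c ∷ []))) ⟨
      B * M₂ * prodFact xs                      ∎)
    where
    open ≡-Reasoning
    xs = j ∷ L ++ c ∷ []
    ys = L ++ c + j ∷ []
    M₁ = multinomial N xs
    M₂ = multinomial N ys
    B = (c + j) C c
    sum-xs : sum xs ≡ N
    sum-xs = trans (cong (j +_) (sum-++ L (c ∷ [])))
      (trans (solve 3 (λ j s c → j :+ (s :+ (c :+ con 0)) := j :+ s :+ c) refl j (sum L) c) eq)
    sum-ys : sum ys ≡ N
    sum-ys = trans (sum-++ L (c + j ∷ []))
      (trans (solve 3 (λ j s c → s :+ (c :+ j :+ con 0) := j :+ s :+ c) refl j (sum L) c) eq)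
    prodFact-ys : prodFact ys ≡ prodFact L * ((B * (c ! * j !)) * 1)
    prodFact-ys = trans (prodFact-++ L (c + j ∷ [])) (cong (λ f → prodFact L * (f * 1)) (sym (C*!*!≡! c j)))

  multinomial-singleton : ∀ N → multinomial N (N ∷ []) ≡ 1
  multinomial-singleton N = *-cancelʳ-≡ _ _ (N ! * 1) {{prodFact-nz (N ∷ [])}}
    (trans (multinomial*prodFact (N ∷ []) (+-identityʳ N)) (sym (trans (*-identityˡ (N ! * 1)) (*-identityʳ (N !)))))

open Multinomial using (sum-toList; multinomial-merge; multinomial-singleton)

j+s+k≡n⇒1+n∸s≡1+k+j : ∀ j s k {n} → j ℕ.+ s ℕ.+ k ≡ n → suc n ∸ s ≡ suc k ℕ.+ j
j+s+k≡n⇒1+n∸s≡1+k+j j s k ≡.refl =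
  ≡.trans (≡.cong (λ x → suc x ∸ s) (solve 3 (λ j s k → j :+ s :+ k := k :+ j :+ s) ≡.refl j s k))
          (ℕₚ.m+n∸n≡m (suc k ℕ.+ j) s)
  where open +-*-Solver

s≡n∸k∸j⇒j+s+k≡n : ∀ {n k j s} → k ≤ n → j ≤ n ∸ k → s ≡ n ∸ k ∸ j → j ℕ.+ s ℕ.+ k ≡ n
s≡n∸k∸j⇒j+s+k≡n {k = k} k≤n j≤n∸k ≡.refl = ≡.trans (≡.cong (ℕ._+ k) (ℕₚ.m+[n∸m]≡n j≤n∸k)) (ℕₚ.m∸n+n≡m k≤n)

k≤n⇒2+n≡1+k+[1+n∸k] : ∀ {n k} → k ≤ n → suc (suc n) ≡ suc k ℕ.+ suc (n ∸ k)
k≤n⇒2+n≡1+k+[1+n∸k] {n} {k} k≤n = ≡.cong suc (≡.trans (≡.cong suc (≡.sym (ℕₚ.m+[n∸m]≡n k≤n))) (≡.sym (ℕₚ.+-suc k (n ∸ k))))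

module _ {c ℓ} (R : CommutativeRing c ℓ) where
  open CommutativeRing R
  open import Algebra.Definitions.RawSemiring (Semiring.rawSemiring semiring) using (_×_; _^_)
  open import Algebra.Properties.Semiring.Mult semiring using (×1-homo-*)
  open import Algebra.Properties.Semiring.Sum semiring
    using (sum; sum-cong-≋; ∑-comm; *-distribˡ-sum; *-distribʳ-sum)
  open import Algebra.Properties.CommutativeSemigroup *-commutativeSemigroup using (interchange)
  open import Relation.Binary.Reasoning.Setoid setoid

  -- Opaque, so that the summand of ∑< n f can be recovered by unification.
  opaque
    ∑< : ℕ → (ℕ → Carrier) → Carrier
    ∑< n f = sum {n} (λ i → f (toℕ i))

  opaque
    unfolding ∑<

    foldr-map-applyUpTo : ∀ (f : ℕ → Carrier) g n →
      foldr _+_ 0# (map f (applyUpTo g n)) ≡ ∑< n (f ∘ g)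
    foldr-map-applyUpTo f g zero    = ≡.refl
    foldr-map-applyUpTo f g (suc n) = ≡.cong (f (g 0) +_) (foldr-map-applyUpTo f (g ∘ suc) n)

    sumTo≡∑< : ∀ n f → sumTo R n f ≡ ∑< (suc n) f
    sumTo≡∑< n f = foldr-map-applyUpTo f (λ i → i) (suc n)

    ∑<-cong : ∀ n {f g} → (∀ i → i < n → f i ≈ g i) → ∑< n f ≈ ∑< n g
    ∑<-cong n f≈g = sum-cong-≋ (λ i → f≈g (toℕ i) (toℕ<n i))

    ∑<-distribˡ : ∀ n x f → x * ∑< n f ≈ ∑< n (λ i → x * f i)
    ∑<-distribˡ n x f = *-distribˡ-sum {n} x (λ i → f (toℕ i))

    ∑<-distribʳ : ∀ n x f → ∑< n f * x ≈ ∑< n (λ i → f i * x)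
    ∑<-distribʳ n x f = *-distribʳ-sum {n} x (λ i → f (toℕ i))

    ∑<-comm : ∀ m n (f : ℕ → ℕ → Carrier) → ∑< m (λ i → ∑< n (f i)) ≈ ∑< n (λ j → ∑< m (λ i → f i j))
    ∑<-comm m n f = ∑-comm {m} {n} (λ i j → f (toℕ i) (toℕ j))

    ∑<-dropˡ : ∀ k r f → (∀ i → i < k → f i ≈ 0#) → ∑< (k ℕ.+ r) f ≈ ∑< r (λ i → f (k ℕ.+ i))
    ∑<-dropˡ zero    r f _  = refl
    ∑<-dropˡ (suc k) r f f≈0 = trans (+-cong (f≈0 0 z<s) (∑<-dropˡ k r (f ∘ suc) (λ i i<k → f≈0 (suc i) (s≤s i<k))))
                                      (+-identityˡ _)

    ∑<-last : ∀ n f → (∀ i → i < n → f i ≈ 0#) → ∑< (suc n) f ≈ f n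
    ∑<-last zero    f _   = +-identityʳ (f 0)
    ∑<-last (suc n) f f≈0 = trans (+-cong (f≈0 0 z<s) (∑<-last n (f ∘ suc) (λ i i<n → f≈0 (suc i) (s≤s i<n))))
                                   (+-identityˡ _)

  ΣList-++ : ∀ xs ys → ΣList R (xs ++ ys) ≈ ΣList R xs + ΣList R ys
  ΣList-++ []       ys = sym (+-identityˡ _)
  ΣList-++ (x ∷ xs) ys = trans (+-congˡ (ΣList-++ xs ys)) (sym (+-assoc _ _ _))

  ΣList-concatMap : ∀ {A B : Set} (F : B → Carrier) (g : A → List B) xs →
    ΣList R (map F (concatMap g xs)) ≈ ΣList R (map (λ x → ΣList R (map F (g x))) xs)
  ΣList-concatMap F g []       = refl
  ΣList-concatMap F g (x ∷ xs) = begin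
    ΣList R (map F (g x ++ concatMap g xs))             ≡⟨ ≡.cong (ΣList R) (map-++ F (g x) (concatMap g xs)) ⟩
    ΣList R (map F (g x) ++ map F (concatMap g xs))     ≈⟨ ΣList-++ (map F (g x)) _ ⟩
    ΣList R (map F (g x)) + ΣList R (map F (concatMap g xs)) ≈⟨ +-congˡ (ΣList-concatMap F g xs) ⟩
    ΣList R (map F (g x)) + ΣList R (map (λ x → ΣList R (map F (g x))) xs) ∎

  ΣList-*ˡ : ∀ {B : Set} x (F : B → Carrier) xs → x * ΣList R (map F xs) ≈ ΣList R (map (λ b → x * F b) xs)
  ΣList-*ˡ x F []       = zeroʳ x
  ΣList-*ˡ x F (b ∷ xs) = trans (distribˡ x _ _) (+-congˡ (ΣList-*ˡ x F xs))

  ΣList-compositions-suc : ∀ m r (F : Vec ℕ (suc m) → Carrier) →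
    ΣList R (map F (compositions (suc m) r)) ≈
    ∑< (suc r) (λ j → ΣList R (map (F ∘ (j ∷_)) (compositions m (r ∸ j))))
  ΣList-compositions-suc m r F = begin
    ΣList R (map F (concatMap (λ j → map (j ∷_) (compositions m (r ∸ j))) (applyUpTo (λ i → i) (suc r))))
      ≈⟨ ΣList-concatMap F (λ j → map (j ∷_) (compositions m (r ∸ j))) (applyUpTo (λ i → i) (suc r)) ⟩
    ΣList R (map (λ j → ΣList R (map F (map (j ∷_) (compositions m (r ∸ j))))) (applyUpTo (λ i → i) (suc r)))
      ≡⟨ foldr-map-applyUpTo _ (λ i → i) (suc r) ⟩
    ∑< (suc r) (λ j → ΣList R (map F (map (j ∷_) (compositions m (r ∸ j)))))
      ≈⟨ ∑<-cong (suc r) (λ j _ → reflexive (≡.cong (ΣList R) (≡.sym (map-∘ {g = F} {f = j ∷_} (compositions m (r ∸ j)))))) ⟩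
    ∑< (suc r) (λ j → ΣList R (map (F ∘ (j ∷_)) (compositions m (r ∸ j)))) ∎

  ΣList-compositions-cong : ∀ m r {F G : Vec ℕ m → Carrier} → (∀ ks → vsum ks ≡ r → F ks ≈ G ks) →
    ΣList R (map F (compositions m r)) ≈ ΣList R (map G (compositions m r))
  ΣList-compositions-cong zero    zero    F≈G = +-congʳ (F≈G [] ≡.refl)
  ΣList-compositions-cong zero    (suc r) F≈G = refl
  ΣList-compositions-cong (suc m) r {F} {G} F≈G = begin
    ΣList R (map F (compositions (suc m) r))
      ≈⟨ ΣList-compositions-suc m r F ⟩
    ∑< (suc r) (λ j → ΣList R (map (F ∘ (j ∷_)) (compositions m (r ∸ j))))
      ≈⟨ ∑<-cong (suc r) (λ j j<1+r → ΣList-compositions-cong m (r ∸ j)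
           (λ ks eq → F≈G (j ∷ ks) (≡.trans (≡.cong (j ℕ.+_) eq) (ℕₚ.m+[n∸m]≡n (ℕₚ.≤-pred j<1+r))))) ⟩
    ∑< (suc r) (λ j → ΣList R (map (G ∘ (j ∷_)) (compositions m (r ∸ j))))
      ≈⟨ ΣList-compositions-suc m r G ⟨
    ΣList R (map G (compositions (suc m) r)) ∎

  module _ (a : Carrier) where

    abelCoeff : ℕ → ℕ → Carrier
    abelCoeff l k = (bin l k × 1#) * (negMul R a l ^ (l ∸ k))

    abelCoeff-< : ∀ {l k} → l < k → abelCoeff l k ≈ 0#
    abelCoeff-< {zero}  _ = zeroˡ _
    abelCoeff-< {suc l} {suc k} (s≤s l<k) =
      trans (*-congʳ (reflexive (≡.cong (_× 1#) (k>n⇒nCk≡0 l<k)))) (zeroˡ _)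

    *-abelCoeff-< : ∀ x {l k} → l < k → x * abelCoeff l k ≈ 0#
    *-abelCoeff-< x l<k = trans (*-congˡ (abelCoeff-< l<k)) (zeroʳ x)

    chain-unfoldʳ : ∀ n k j l →
      chain R a n k (suc j) l ≈ ∑< (suc n) (λ l′ → chain R a n l′ j l * abelCoeff l′ k)
    chain-unfoldʳ n k zero    l = reflexive (sumTo≡∑< n _)
    chain-unfoldʳ n k (suc j) l = begin
      chain R a n k (suc (suc j)) l
        ≡⟨ sumTo≡∑< n _ ⟩
      ∑< (suc n) (λ l′ → abelCoeff l l′ * chain R a n k (suc j) l′)
        ≈⟨ ∑<-cong (suc n) (λ l′ _ → *-congˡ (chain-unfoldʳ n k j l′)) ⟩
      ∑< (suc n) (λ l′ → abelCoeff l l′ * ∑< (suc n) (λ l″ → chain R a n l″ j l′ * abelCoeff l″ k))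
        ≈⟨ ∑<-cong (suc n) (λ l′ _ → trans (∑<-distribˡ (suc n) _ _) (∑<-cong (suc n) (λ l″ _ → sym (*-assoc _ _ _)))) ⟩
      ∑< (suc n) (λ l′ → ∑< (suc n) (λ l″ → abelCoeff l l′ * chain R a n l″ j l′ * abelCoeff l″ k))
        ≈⟨ ∑<-comm (suc n) (suc n) (λ l′ l″ → abelCoeff l l′ * chain R a n l″ j l′ * abelCoeff l″ k) ⟩
      ∑< (suc n) (λ l″ → ∑< (suc n) (λ l′ → abelCoeff l l′ * chain R a n l″ j l′ * abelCoeff l″ k))
        ≈⟨ ∑<-cong (suc n) (λ l″ _ → sym (∑<-distribʳ (suc n) _ _)) ⟩
      ∑< (suc n) (λ l″ → ∑< (suc n) (λ l′ → abelCoeff l l′ * chain R a n l″ j l′) * abelCoeff l″ k)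
        ≈⟨ ∑<-cong (suc n) (λ l″ _ → *-congʳ (reflexive (≡.sym (sumTo≡∑< n _)))) ⟩
      ∑< (suc n) (λ l″ → chain R a n l″ (suc j) l * abelCoeff l″ k) ∎

    rhsTerm : ℕ → ℕ → ∀ {m} → Vec ℕ m → Carrier
    rhsTerm n k ks = (multinomial (n ∸ 1) (toList ks ++ (k ∸ 1) ∷ []) × 1#) * prodTerm R a n ks

    rhsTerm-cons : ∀ {n k m} j (ks : Vec ℕ m) → j ℕ.+ vsum ks ℕ.+ k ≡ n →
      rhsTerm (suc n) (suc k) (j ∷ ks) ≈ abelCoeff (suc k ℕ.+ j) (suc k) * rhsTerm (suc n) (suc k ℕ.+ j) ks
    rhsTerm-cons {n} {k} j ks eq = begin
      (multinomial n (j ∷ toList ks ++ k ∷ []) × 1#) * ((negMul R a (suc n ∸ vsum ks) ^ j) * prodTerm R a (suc n) ks)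
        ≈⟨ *-cong (reflexive (≡.cong (_× 1#) merge)) (*-congʳ (reflexive (≡.cong (λ l → negMul R a l ^ j) base))) ⟩
      ((((k ℕ.+ j) C k) ℕ.* M) × 1#) * ((negMul R a (suc k ℕ.+ j) ^ j) * prodTerm R a (suc n) ks)
        ≈⟨ *-congʳ (×1-homo-* ((k ℕ.+ j) C k) M) ⟩
      ((((k ℕ.+ j) C k) × 1#) * (M × 1#)) * ((negMul R a (suc k ℕ.+ j) ^ j) * prodTerm R a (suc n) ks)
        ≈⟨ interchange _ _ _ _ ⟩
      ((((k ℕ.+ j) C k) × 1#) * (negMul R a (suc k ℕ.+ j) ^ j)) * rhsTerm (suc n) (suc k ℕ.+ j) ks
        ≡⟨ ≡.cong (λ e → ((((k ℕ.+ j) C k) × 1#) * (negMul R a (suc k ℕ.+ j) ^ e)) * rhsTerm (suc n) (suc k ℕ.+ j) ks)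
                  (≡.sym (ℕₚ.m+n∸m≡n k j)) ⟩
      abelCoeff (suc k ℕ.+ j) (suc k) * rhsTerm (suc n) (suc k ℕ.+ j) ks ∎
      where
      M = multinomial n (toList ks ++ k ℕ.+ j ∷ [])
      merge : multinomial n (j ∷ toList ks ++ k ∷ []) ≡ ((k ℕ.+ j) C k) ℕ.* M
      merge = multinomial-merge j k (toList ks) (≡.trans (≡.cong (λ s → j ℕ.+ s ℕ.+ k) (sum-toList ks)) eq)
      base : suc n ∸ vsum ks ≡ suc k ℕ.+ j
      base = j+s+k≡n⇒1+n∸s≡1+k+j j (vsum ks) k eq

    RHS-step : ∀ {n k} m → k ≤ n →
      RHS R a (suc n) (suc m) (suc k) ≈ ∑< (suc (suc n)) (λ l → RHS R a (suc n) m l * abelCoeff l (suc k))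
    RHS-step {n} {k} m k≤n = begin
      RHS R a (suc n) (suc m) (suc k)
        ≈⟨ ΣList-compositions-suc m r (rhsTerm (suc n) (suc k)) ⟩
      ∑< (suc r) (λ j → ΣList R (map (rhsTerm (suc n) (suc k) ∘ (j ∷_)) (compositions m (r ∸ j))))
        ≈⟨ ∑<-cong (suc r) (λ j j<1+r → first-part j (ℕₚ.≤-pred j<1+r)) ⟩
      ∑< (suc r) (λ j → abelCoeff (suc k ℕ.+ j) (suc k) * RHS R a (suc n) m (suc k ℕ.+ j))
        ≈⟨ ∑<-cong (suc r) (λ j _ → *-comm _ _) ⟩
      ∑< (suc r) (λ j → f (suc k ℕ.+ j))
        ≈⟨ ∑<-dropˡ (suc k) (suc r) f (λ l → *-abelCoeff-< (RHS R a (suc n) m l)) ⟨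
      ∑< (suc k ℕ.+ suc r) f
        ≡⟨ ≡.cong (λ N → ∑< N f) (k≤n⇒2+n≡1+k+[1+n∸k] k≤n) ⟨
      ∑< (suc (suc n)) f ∎
      where
      r = n ∸ k
      f : ℕ → Carrier
      f l = RHS R a (suc n) m l * abelCoeff l (suc k)
      first-part : ∀ j → j ≤ r →
        ΣList R (map (rhsTerm (suc n) (suc k) ∘ (j ∷_)) (compositions m (r ∸ j))) ≈
        abelCoeff (suc k ℕ.+ j) (suc k) * RHS R a (suc n) m (suc k ℕ.+ j)
      first-part j j≤r = begin
        ΣList R (map (rhsTerm (suc n) (suc k) ∘ (j ∷_)) (compositions m (r ∸ j)))
          ≈⟨ ΣList-compositions-cong m (r ∸ j) (λ ks eq → rhsTerm-cons j ks (s≡n∸k∸j⇒j+s+k≡n k≤n j≤r eq)) ⟩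
        ΣList R (map (λ ks → A * rhsTerm (suc n) (suc k ℕ.+ j) ks) (compositions m (r ∸ j)))
          ≈⟨ ΣList-*ˡ A (rhsTerm (suc n) (suc k ℕ.+ j)) (compositions m (r ∸ j)) ⟨
        A * ΣList R (map (rhsTerm (suc n) (suc k ℕ.+ j)) (compositions m (r ∸ j)))
          ≡⟨ ≡.cong (λ t → A * ΣList R (map (rhsTerm (suc n) (suc k ℕ.+ j)) (compositions m t))) (ℕₚ.∸-+-assoc n k j) ⟩
        A * RHS R a (suc n) m (suc k ℕ.+ j) ∎
        where A = abelCoeff (suc k ℕ.+ j) (suc k)

    RHS-zero-< : ∀ {n l} → l < n → RHS R a n 0 l ≈ 0#
    RHS-zero-< {n} {l} l<n = no-compositions (n ∸ l) (ℕₚ.m<n⇒0<n∸m l<n)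
      where
      no-compositions : ∀ r → 0 < r → ΣList R (map (rhsTerm n l) (compositions 0 r)) ≈ 0#
      no-compositions (suc r) _ = refl

    RHS-zero-diag : ∀ n → RHS R a (suc n) 0 (suc n) ≈ 1#
    RHS-zero-diag n = begin
      ΣList R (map (rhsTerm (suc n) (suc n)) (compositions 0 (n ∸ n)))
        ≡⟨ ≡.cong (λ r → ΣList R (map (rhsTerm (suc n) (suc n)) (compositions 0 r))) (ℕₚ.n∸n≡0 n) ⟩
      (multinomial n (n ∷ []) × 1#) * 1# + 0#
        ≡⟨ ≡.cong (λ t → (t × 1#) * 1# + 0#) (multinomial-singleton n) ⟩
      (1# + 0#) * 1# + 0#
        ≈⟨ trans (+-identityʳ _) (trans (*-identityʳ _) (+-identityʳ _)) ⟩
      1# ∎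

    RHS-one : ∀ {n k} → k ≤ n → RHS R a (suc n) 1 (suc k) ≈ abelCoeff (suc n) (suc k)
    RHS-one {n} {k} k≤n = begin
      RHS R a (suc n) 1 (suc k)
        ≈⟨ RHS-step 0 k≤n ⟩
      ∑< (suc (suc n)) (λ l → RHS R a (suc n) 0 l * abelCoeff l (suc k))
        ≈⟨ ∑<-last (suc n) _ (λ l l<1+n → trans (*-congʳ (RHS-zero-< l<1+n)) (zeroˡ _)) ⟩
      RHS R a (suc n) 0 (suc n) * abelCoeff (suc n) (suc k)
        ≈⟨ trans (*-congʳ (RHS-zero-diag n)) (*-identityˡ _) ⟩
      abelCoeff (suc n) (suc k) ∎

    chain≈RHS : ∀ j {n k} → k ≤ n → chain R a (suc n) (suc k) j (suc n) ≈ RHS R a (suc n) (suc j) (suc k)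
    chain≈RHS zero    k≤n = sym (RHS-one k≤n)
    chain≈RHS (suc j) {n} {k} k≤n = begin
      chain R a (suc n) (suc k) (suc j) (suc n)
        ≈⟨ chain-unfoldʳ (suc n) (suc k) j (suc n) ⟩
      ∑< (suc (suc n)) (λ l → chain R a (suc n) l j (suc n) * abelCoeff l (suc k))
        ≈⟨ ∑<-cong (suc (suc n)) (λ l l<2+n → termwise l (ℕₚ.≤-pred l<2+n)) ⟩
      ∑< (suc (suc n)) (λ l → RHS R a (suc n) (suc j) l * abelCoeff l (suc k))
        ≈⟨ RHS-step (suc j) k≤n ⟨
      RHS R a (suc n) (suc (suc j)) (suc k) ∎
      where
      termwise : ∀ l → l ≤ suc n →
        chain R a (suc n) l j (suc n) * abelCoeff l (suc k) ≈ RHS R a (suc n) (suc j) l * abelCoeff l (suc k)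
      termwise zero    _       = trans (*-abelCoeff-< (chain R a (suc n) 0 j (suc n)) (z<s {k}))
                                       (sym (*-abelCoeff-< (RHS R a (suc n) (suc j) 0) (z<s {k})))
      termwise (suc l) 1+l≤1+n = *-congʳ (chain≈RHS j (ℕₚ.≤-pred 1+l≤1+n))

theorem3 : ∀ {c ℓ} (R : CommutativeRing c ℓ) (a : CommutativeRing.Carrier R)
    → ¬ (CommutativeRing._≈_ R a (CommutativeRing.0# R))
    → (n m k : ℕ) → 1 ≤ n → 1 ≤ m → 1 ≤ k → k ≤ n
    → CommutativeRing._≈_ R (LHS R a n m k) (RHS R a n m k)
theorem3 R a _ (suc n) (suc j) (suc k) _ (s≤s z≤n) _ (s≤s k≤n) = chain≈RHS R a j k≤n
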